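{- Let $G$ be a graph and let $w$ be a universal vertex of $G$ (i.e., $N_G[w]=V(G)$). Then $w$ is avoidable in $G$ if and only if $G$ is a complete graph. Moreover, any vertex $u\in V(G)\setminus\{w\}$ is avoidable in $G$ if and only if $u$ is avoidable in $G-w$.
   Context: All graphs are finite, simple and undirected. A vertex $v$ of a graph $G$ is avoidable if every induced path on three vertices with middle vertex $v$ is contained in an induced cycle of $G$. -}

module Defs where

open import Data.Nat using (ℕ; suc; _+_; _%_)
open import Data.Nat.DivMod using (m%n<n)
open import Data.Fin using (Fin; toℕ; fromℕ<; punchIn)
open import Data.Bool using (Bool; true; false)
open import Data.Product using (Σ; ∃; _×_; _,_)
open import Data.Sum using (_⊎_)
open import Relation.Binary.PropositionalEquality using (_≡_; _≢_)
open import Relation.Nullary using (¬_)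
open import Function.Bundles using (_⇔_)

record Graph (n : ℕ) : Set where
  field
    adj    : Fin n → Fin n → Bool
    sym    : ∀ i j → adj i j ≡ adj j i
    irrefl : ∀ i → adj i i ≡ false

open Graph public

Adj : ∀ {n} → Graph n → Fin n → Fin n → Set
Adj G a b = adj G a b ≡ true

next : ∀ {k} → Fin (suc k) → Fin (suc k)
next {k} i = fromℕ< (m%n<n (suc (toℕ i)) (suc k))

Consec : ∀ {k} → Fin (suc k) → Fin (suc k) → Set
Consec i j = (j ≡ next i) ⊎ (i ≡ next j)

record InducedCycle {n : ℕ} (G : Graph n) : Set where
  field
    len    : ℕ
    vtx    : Fin (suc (suc (suc len))) → Fin n
    inj    : ∀ {i j} → vtx i ≡ vtx j → i ≡ j
    induced : ∀ i j → Adj G (vtx i) (vtx j) ⇔ Consec i j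

open InducedCycle public

CycleEdge : ∀ {n} {G : Graph n} → InducedCycle G → Fin n → Fin n → Set
CycleEdge C a b = ∃ λ i → ∃ λ j → Consec i j × vtx C i ≡ a × vtx C j ≡ b

InducedP3 : ∀ {n} → Graph n → Fin n → Fin n → Fin n → Set
InducedP3 G x v y = x ≢ y × Adj G x v × Adj G v y × ¬ Adj G x y

Avoidable : ∀ {n} → Graph n → Fin n → Set
Avoidable G v = ∀ x y → InducedP3 G x v y →
  Σ (InducedCycle G) λ C → CycleEdge C x v × CycleEdge C v y

Universal : ∀ {n} → Graph n → Fin n → Set
Universal G w = ∀ a → a ≢ w → Adj G w a

Complete : ∀ {n} → Graph n → Set
Complete G = ∀ a b → a ≢ b → Adj G a b

-- G - w : delete vertex w; vertex i of G - w is vertex punchIn w i of G.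
deleteVertex : ∀ {n} → Graph (suc n) → Fin (suc n) → Graph n
deleteVertex G w = record
  { adj    = λ i j → adj G (punchIn w i) (punchIn w j)
  ; sym    = λ i j → sym G (punchIn w i) (punchIn w j)
  ; irrefl = λ i → irrefl G (punchIn w i)
  }

-- On an induced cycle of length at least four every vertex has a non-neighbour
-- on the cycle, the vertex two steps ahead, so a universal vertex w lies on
-- induced triangles only. A triangle cannot contain the two non-adjacent ends of
-- an induced P₃, so no induced P₃ centred at w extends to an induced cycle, and
-- for u ≠ w the induced cycles through an induced P₃ centred at u avoid w. As
-- the ends of such a P₃ are not w either (w is adjacent to everything), the
-- witnesses for the avoidability of u in G and in G - w are the same cycles.
module Submission where

open import Defs
open import Data.Bool using (true)
import Data.Bool.Properties as Bool
open import Data.Empty using (⊥-elim)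
open import Data.Fin using (Fin; zero; suc; toℕ; punchIn; punchOut; _≟_)
open import Data.Fin.Properties
  using (toℕ-fromℕ<; toℕ<n; punchIn-injective; punchIn-punchOut)
open import Data.Nat using (zero; suc; _+_; _∸_; _%_; _<_; _<?_; z≤n; s≤s; NonZero)
open import Data.Nat.DivMod
open import Data.Nat.GeneralisedArithmetic using (iterate)
open import Data.Nat.Properties
  using (m<m+n; <⇒≢; ≮⇒≥; ≤-<-trans; m+n∸n≡m; ∸-monoˡ-<; +-monoʳ-<; +-identityʳ; +-suc)
open import Data.Product using (_×_; _,_; ∃)
open import Data.Sum using (inj₁; inj₂)
open import Function.Base using (_∘_)
open import Function.Bundles using (_⇔_; mk⇔; Equivalence)
open import Relation.Binary.PropositionalEquality as ≡
  using (_≡_; _≢_; refl; trans; cong; subst₂; module ≡-Reasoning)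
open import Relation.Nullary using (¬_; yes; no)
open import Relation.Nullary.Decidable using (decidable-stable)

[m%n+k]%n≡[m+k]%n : ∀ m k n .{{_ : NonZero n}} → (m % n + k) % n ≡ (m + k) % n
[m%n+k]%n≡[m+k]%n m k n = begin
  (m % n + k) % n            ≡⟨ %-distribˡ-+ (m % n) k n ⟩
  (m % n % n + k % n) % n    ≡⟨ cong (λ r → (r + k % n) % n) (m%n%n≡m%n m n) ⟩
  (m % n + k % n) % n        ≡⟨ ≡.sym (%-distribˡ-+ m k n) ⟩
  (m + k) % n                ∎
  where open ≡-Reasoning

[m+k]%n≢m : ∀ {m k n} .{{_ : NonZero n}} → m < n → 0 < k → k < n → (m + k) % n ≢ m
[m+k]%n≢m {m} {k} {n} m<n 0<k k<n with m + k <? n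
... | yes m+k<n = <⇒≢ (m<m+n m 0<k) ∘ ≡.sym ∘ trans (≡.sym (m<n⇒m%n≡m m+k<n))
... | no m+k≮n = <⇒≢ wrapped-below ∘ trans (m≤n⇒[n∸m]%m≡n%m n≤m+k)
  where
  n≤m+k = ≮⇒≥ m+k≮n
  wrapped-below : (m + k ∸ n) % n < m
  wrapped-below = ≤-<-trans (m%n≤m (m + k ∸ n) n)
    (≡.subst (m + k ∸ n <_) (m+n∸n≡m m n) (∸-monoˡ-< (+-monoʳ-< m k<n) n≤m+k))

toℕ-iterate-next : ∀ {K} (i : Fin (suc K)) k → toℕ (iterate next i k) ≡ (toℕ i + k) % suc K
toℕ-iterate-next {K} i zero =
  ≡.sym (trans (cong (_% suc K) (+-identityʳ (toℕ i))) (m<n⇒m%n≡m (toℕ<n i)))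
toℕ-iterate-next {K} i (suc k) = begin
  toℕ (iterate next (next i) k)       ≡⟨ toℕ-iterate-next (next i) k ⟩
  (toℕ (next i) + k) % suc K          ≡⟨ cong (λ r → (r + k) % suc K) toℕ-next ⟩
  (suc (toℕ i) % suc K + k) % suc K   ≡⟨ [m%n+k]%n≡[m+k]%n (suc (toℕ i)) k (suc K) ⟩
  (suc (toℕ i) + k) % suc K           ≡⟨ cong (_% suc K) (≡.sym (+-suc (toℕ i) k)) ⟩
  (toℕ i + suc k) % suc K             ∎
  where
  open ≡-Reasoning
  toℕ-next : toℕ (next i) ≡ suc (toℕ i) % suc K
  toℕ-next = toℕ-fromℕ< (m%n<n (suc (toℕ i)) (suc K))

iterate-next-≢ : ∀ {K k} (i : Fin (suc K)) → 0 < k → k < suc K → iterate next i k ≢ i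
iterate-next-≢ i 0<k k<N =
  [m+k]%n≢m (toℕ<n i) 0<k k<N ∘ trans (≡.sym (toℕ-iterate-next i _)) ∘ cong toℕ

next²≢ : ∀ {m} (i : Fin (4 + m)) → next (next i) ≢ i
next²≢ i = iterate-next-≢ i (s≤s z≤n) (s≤s (s≤s (s≤s z≤n)))

¬Consec-next² : ∀ {m} (i : Fin (4 + m)) → ¬ Consec i (next (next i))
¬Consec-next² i (inj₁ eq) = iterate-next-≢ (next i) (s≤s z≤n) (s≤s (s≤s z≤n)) eq
¬Consec-next² i (inj₂ eq) =
  iterate-next-≢ i (s≤s z≤n) (s≤s (s≤s (s≤s (s≤s z≤n)))) (≡.sym eq)

Consec-Fin3 : (i j : Fin 3) → i ≢ j → Consec i j
Consec-Fin3 zero             zero             i≢j = ⊥-elim (i≢j refl)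
Consec-Fin3 zero             (suc zero)       _   = inj₁ refl
Consec-Fin3 zero             (suc (suc zero)) _   = inj₂ refl
Consec-Fin3 (suc zero)       zero             _   = inj₂ refl
Consec-Fin3 (suc zero)       (suc zero)       i≢j = ⊥-elim (i≢j refl)
Consec-Fin3 (suc zero)       (suc (suc zero)) _   = inj₁ refl
Consec-Fin3 (suc (suc zero)) zero             _   = inj₁ refl
Consec-Fin3 (suc (suc zero)) (suc zero)       _   = inj₂ refl
Consec-Fin3 (suc (suc zero)) (suc (suc zero)) i≢j = ⊥-elim (i≢j refl)

module _ {n} {G : Graph n} where

  universal-adjˡ : ∀ {w a} → Universal G w → a ≢ w → Adj G a w
  universal-adjˡ {w} {a} U a≢w = trans (sym G a w) (U a a≢w)

  triangle-complete : (C : InducedCycle G) → len C ≡ 0 →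
    ∀ {i j} → i ≢ j → Adj G (vtx C i) (vtx C j)
  triangle-complete record { len = zero ; induced = ind } refl {i} {j} i≢j =
    Equivalence.from (ind i j) (Consec-Fin3 i j i≢j)

  universal-onCycle⇒triangle : ∀ {w} → Universal G w →
    (C : InducedCycle G) → ∀ {i} → vtx C i ≡ w → len C ≡ 0
  universal-onCycle⇒triangle U record { len = zero } _ = refl
  universal-onCycle⇒triangle U C@record { len = suc _ } {i} refl =
    ⊥-elim (¬Consec-next² i (Equivalence.to (induced C i j) (U (vtx C j) (next²≢ i ∘ inj C))))
    where j = next (next i)

  inducedP3-cycle-avoids-universal : ∀ {w x v y} {C : InducedCycle G} →
    Universal G w → InducedP3 G x v y → CycleEdge C x v → CycleEdge C v y →
    ∀ i → vtx C i ≢ w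
  inducedP3-cycle-avoids-universal {C = C} U (x≢y , _ , _ , ¬xy)
    (_ , _ , _ , refl , _) (_ , _ , _ , _ , refl) i vi≡w =
    ¬xy (triangle-complete C (universal-onCycle⇒triangle U C vi≡w) (x≢y ∘ cong (vtx C)))

  inducedP3-ends≢universal : ∀ {w x v y} → Universal G w → InducedP3 G x v y →
    x ≢ w × y ≢ w
  inducedP3-ends≢universal {y = y} U (x≢y , _ , _ , ¬xy) =
    (λ { refl → ¬xy (U y (x≢y ∘ ≡.sym)) }) , (λ { refl → ¬xy (universal-adjˡ U x≢y) })

  complete⇒avoidable : Complete G → ∀ v → Avoidable G v
  complete⇒avoidable K v x y (x≢y , _ , _ , ¬xy) = ⊥-elim (¬xy (K x y x≢y))

  avoidable-universal⇒¬InducedP3 : ∀ {w x y} → Universal G w → Avoidable G w →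
    ¬ InducedP3 G x w y
  avoidable-universal⇒¬InducedP3 {x = x} {y} U av p with av x y p
  ... | C , e₁@(_ , j , _ , _ , vj≡w) , e₂ =
    inducedP3-cycle-avoids-universal {C = C} U p e₁ e₂ j vj≡w

  avoidable-universal⇒complete : ∀ {w} → Universal G w → Avoidable G w → Complete G
  avoidable-universal⇒complete {w} U av a b a≢b =
    decidable-stable (adj G a b Bool.≟ true) ¬¬adjacent
    where
    ¬¬adjacent : ¬ ¬ Adj G a b
    ¬¬adjacent ¬ab with a ≟ w | b ≟ w
    ... | yes refl | _        = ¬ab (U b (a≢b ∘ ≡.sym))
    ... | no _     | yes refl = ¬ab (universal-adjˡ U a≢b)
    ... | no a≢w   | no b≢w   =
      avoidable-universal⇒¬InducedP3 U av (a≢b , universal-adjˡ U a≢w , U b b≢w , ¬ab)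

punchIn-onto : ∀ {n} {w x : Fin (suc n)} → x ≢ w → ∃ λ x′ → punchIn w x′ ≡ x
punchIn-onto x≢w = punchOut (x≢w ∘ ≡.sym) , punchIn-punchOut (x≢w ∘ ≡.sym)

module _ {n} {G : Graph (suc n)} {w : Fin (suc n)} where

  deleteVertex-InducedP3 : ∀ {x v y} → InducedP3 (deleteVertex G w) x v y →
    InducedP3 G (punchIn w x) (punchIn w v) (punchIn w y)
  deleteVertex-InducedP3 (x≢y , p) = x≢y ∘ punchIn-injective w _ _ , p

  InducedP3-deleteVertex : ∀ {x v y} →
    InducedP3 G (punchIn w x) (punchIn w v) (punchIn w y) → InducedP3 (deleteVertex G w) x v y
  InducedP3-deleteVertex (x≢y , p) = x≢y ∘ cong (punchIn w) , p

  liftCycle : InducedCycle (deleteVertex G w) → InducedCycle G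
  liftCycle C = record
    { len     = len C
    ; vtx     = punchIn w ∘ vtx C
    ; inj     = inj C ∘ punchIn-injective w _ _
    ; induced = induced C
    }

  liftCycle-edge : ∀ C {a b} → CycleEdge C a b →
    CycleEdge (liftCycle C) (punchIn w a) (punchIn w b)
  liftCycle-edge _ (i , j , c , refl , refl) = i , j , c , refl , refl

  module _ (C : InducedCycle G) (avoids : ∀ i → vtx C i ≢ w) where

    restrictVtx : Fin (3 + len C) → Fin n
    restrictVtx i = punchOut (avoids i ∘ ≡.sym)

    punchIn-restrictVtx : ∀ i → punchIn w (restrictVtx i) ≡ vtx C i
    punchIn-restrictVtx i = punchIn-punchOut (avoids i ∘ ≡.sym)

    restrictCycle : InducedCycle (deleteVertex G w)
    restrictCycle = record
      { len     = len C
      ; vtx     = restrictVtx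
      ; inj     = λ {i} {j} eq → inj C (begin
          vtx C i                     ≡⟨ ≡.sym (punchIn-restrictVtx i) ⟩
          punchIn w (restrictVtx i)   ≡⟨ cong (punchIn w) eq ⟩
          punchIn w (restrictVtx j)   ≡⟨ punchIn-restrictVtx j ⟩
          vtx C j                     ∎)
      ; induced = λ i j → subst₂ (λ a b → Adj G a b ⇔ Consec i j)
          (≡.sym (punchIn-restrictVtx i)) (≡.sym (punchIn-restrictVtx j)) (induced C i j)
      }
      where open ≡-Reasoning

    restrictCycle-edge : ∀ {a b} → CycleEdge C (punchIn w a) (punchIn w b) →
      CycleEdge restrictCycle a b
    restrictCycle-edge (i , j , c , vi≡a , vj≡b) =
      i , j , c , punchIn-injective w _ _ (trans (punchIn-restrictVtx i) vi≡a)
                , punchIn-injective w _ _ (trans (punchIn-restrictVtx j) vj≡b)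

  avoidable-deleteVertex⇒avoidable : Universal G w → ∀ u →
    Avoidable (deleteVertex G w) u → Avoidable G (punchIn w u)
  avoidable-deleteVertex⇒avoidable U u av x y p with inducedP3-ends≢universal {G = G} U p
  ... | x≢w , y≢w with punchIn-onto x≢w | punchIn-onto y≢w
  ... | x′ , refl | y′ , refl with av x′ y′ (InducedP3-deleteVertex p)
  ... | C , e₁ , e₂ = liftCycle C , liftCycle-edge C e₁ , liftCycle-edge C e₂

  avoidable⇒avoidable-deleteVertex : Universal G w → ∀ u →
    Avoidable G (punchIn w u) → Avoidable (deleteVertex G w) u
  avoidable⇒avoidable-deleteVertex U u av x y p with av _ _ (deleteVertex-InducedP3 p)
  ... | C , e₁ , e₂ =
    let avoids = inducedP3-cycle-avoids-universal {G = G} {C = C} U (deleteVertex-InducedP3 p) e₁ e₂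
    in restrictCycle C avoids , restrictCycle-edge C avoids e₁ , restrictCycle-edge C avoids e₂

lemma9 : ∀ {n} (G : Graph (suc n)) (w : Fin (suc n)) → Universal G w →
    (Avoidable G w ⇔ Complete G) ×
    (∀ (u : Fin n) → Avoidable G (punchIn w u) ⇔ Avoidable (deleteVertex G w) u)
lemma9 G w U =
  mk⇔ (avoidable-universal⇒complete U) (λ K → complete⇒avoidable K w) ,
  λ u → mk⇔ (avoidable⇒avoidable-deleteVertex U u) (avoidable-deleteVertex⇒avoidable U u)
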